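{- Let $m,n\geq 3$ be integers. If there exist $X,Y\in M_2(\mathbb{Z})$ with $\det(X)\det(Y)\neq 0$ and $X^m-Y^n=I$, then there exist algebraic integers $x,y$, each of degree at most $2$ over $\mathbb{Q}$, with $xy\neq 0$ and $x^m-y^n=1$.
   Context: $I$ denotes the $2\times 2$ identity matrix. -}

module Defs where

open import Level using (0ℓ)
open import Data.Nat using (ℕ; zero; suc)
open import Data.Integer using (ℤ; +_; -[1+_]) renaming (_+_ to _+ℤ_; _*_ to _*ℤ_; _-_ to _-ℤ_)
open import Data.Product using (Σ; ∃; _×_)
open import Relation.Nullary using (¬_)
open import Algebra.Bundles using (CommutativeRing; Semiring)
import Algebra.Definitions.RawSemiring as RS

record M₂ℤ : Set where
  constructor mat
  field
    a b c d : ℤ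

open M₂ℤ public

I₂ : M₂ℤ
I₂ = mat (+ 1) (+ 0) (+ 0) (+ 1)

_·_ : M₂ℤ → M₂ℤ → M₂ℤ
mat a₁ b₁ c₁ d₁ · mat a₂ b₂ c₂ d₂ =
  mat (a₁ *ℤ a₂ +ℤ b₁ *ℤ c₂) (a₁ *ℤ b₂ +ℤ b₁ *ℤ d₂)
      (c₁ *ℤ a₂ +ℤ d₁ *ℤ c₂) (c₁ *ℤ b₂ +ℤ d₁ *ℤ d₂)

_−ₘ_ : M₂ℤ → M₂ℤ → M₂ℤ
mat a₁ b₁ c₁ d₁ −ₘ mat a₂ b₂ c₂ d₂ = mat (a₁ -ℤ a₂) (b₁ -ℤ b₂) (c₁ -ℤ c₂) (d₁ -ℤ d₂)

_^ₘ_ : M₂ℤ → ℕ → M₂ℤ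
X ^ₘ zero  = I₂
X ^ₘ suc k = X · (X ^ₘ k)

det : M₂ℤ → ℤ
det (mat a b c d) = a *ℤ d -ℤ b *ℤ c

record CharZeroField : Set₁ where
  field
    cring : CommutativeRing 0ℓ 0ℓ
  open CommutativeRing cring public
  open RS (Semiring.rawSemiring semiring) public using (_^_) renaming (_×_ to _⊗_)
  field
    1≉0      : ¬ (1# ≈ 0#)
    inverse  : ∀ x → ¬ (x ≈ 0#) → ∃ λ y → x * y ≈ 1#
    charZero : ∀ k → ¬ ((suc k ⊗ 1#) ≈ 0#)

  ι : ℤ → Carrier
  ι (+ n)     = n ⊗ 1#
  ι -[1+ n ]  = - (suc n ⊗ 1#)

  -- x is an algebraic integer of degree ≤ 2 over ℚ:
  -- a root of a monic integer polynomial t² + p t + q.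
  IsQuadAlgInt : Carrier → Set
  IsQuadAlgInt x = Σ ℤ λ p → Σ ℤ λ q → (x * x + ι p * x + ι q) ≈ 0#

{-# OPTIONS --safe #-}
module Submission where

-- Work in a field K of characteristic zero containing square roots of disc X and
-- disc Y; it is obtained from ℚ by adjoining at most two square roots, adjoining √D
-- only when D is not already a square, which is decidable at every stage. Over K, Y
-- has an eigenvector w, with eigenvalue y. If Yⁿ is scalar then so is Xᵐ = I + Yⁿ,
-- and for an eigenvector of X with eigenvalue x, xᵐ and yⁿ are the diagonal entries
-- of Xᵐ and Yⁿ, which differ by 1. Otherwise X commutes with the non-scalar matrix
-- Yⁿ = Xᵐ - I, so X is a rational combination of I and Yⁿ and w is an eigenvector
-- of X too; applying Xᵐ - Yⁿ = I to w gives xᵐ - yⁿ = 1. Eigenvalues are roots of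
-- the monic integer polynomial t² - (tr A) t + det A, and are nonzero as det A ≠ 0.

open import Defs
open import Level using (0ℓ)
open import Data.Nat as ℕ using (ℕ; zero; suc; _≥_; _<_)
import Data.Nat.Properties as ℕ
open import Data.Nat.Divisibility using (divides; ∣-refl)
open import Data.Nat.Coprimality using (Coprime; coprime?; coprime-divisor)
import Data.Nat.Coprimality as Coprimality
open import Data.Integer as ℤ using (ℤ; +_; -[1+_]; _⊖_) renaming (_*_ to _*ℤ_)
import Data.Integer.Properties as ℤ
open import Data.Integer.Tactic.RingSolver using (solve-∀)
open import Data.Rational as ℚ using (mkℚ; 1ℚ; toℚᵘ)
import Data.Rational.Properties as ℚ
open import Data.Rational.Unnormalised as ℚᵘ using (mkℚᵘ; *≡*) renaming (_≃_ to _≃ᵘ_)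
import Data.Rational.Unnormalised.Properties as ℚᵘ
open import Data.Empty using (⊥-elim)
open import Data.Maybe using (Maybe; just; nothing)
open import Data.Product using (Σ; _×_; _,_; proj₁; proj₂)
open import Data.Product.Relation.Binary.Pointwise.NonDependent using (×-setoid)
open import Data.Sum using (_⊎_; inj₁; inj₂)
open import Function using (_∘_)
open import Relation.Nullary using (¬_; Dec; yes; no)
open import Relation.Nullary.Decidable using (_×-dec_; map′; recompute)
open import Relation.Binary.Bundles using (Setoid)
import Relation.Binary.PropositionalEquality as ≡
open ≡ using (_≡_; _≢_)
open import Algebra.Bundles using (CommutativeRing; AbelianGroup; Semiring)
open import Algebra.Construct.DirectProduct using (abelianGroup)
import Algebra.Consequences.Setoid as Consequences
import Algebra.Definitions.RawSemiring as RawSemiringDefinitions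
import Algebra.Solver.Ring
import Algebra.Solver.Ring.AlmostCommutativeRing as ACR

-- Integer matrices

module _ where
  open import Data.Integer using (_+_; _*_; _-_; _≟_)
  open ≡

  IsScalar : M₂ℤ → Set
  IsScalar M = b M ≡ + 0 × c M ≡ + 0 × a M ≡ d M

  isScalar? : ∀ M → Dec (IsScalar M)
  isScalar? M = (b M ≟ + 0) ×-dec (c M ≟ + 0) ×-dec (a M ≟ d M)

  Commute : M₂ℤ → M₂ℤ → Set
  Commute A B = A · B ≡ B · A

  mat-cong : ∀ {a b c d a′ b′ c′ d′} → a ≡ a′ → b ≡ b′ → c ≡ c′ → d ≡ d′ →
             mat a b c d ≡ mat a′ b′ c′ d′
  mat-cong refl refl refl refl = refl

  ·-assoc : ∀ A B C → (A · B) · C ≡ A · (B · C)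
  ·-assoc (mat a₁ b₁ c₁ d₁) (mat a₂ b₂ c₂ d₂) (mat a₃ b₃ c₃ d₃) =
    mat-cong (entry a₁ b₁ a₃ c₃ a₂ b₂ c₂ d₂) (entry a₁ b₁ b₃ d₃ a₂ b₂ c₂ d₂)
             (entry c₁ d₁ a₃ c₃ a₂ b₂ c₂ d₂) (entry c₁ d₁ b₃ d₃ a₂ b₂ c₂ d₂)
    where
    entry : ∀ x y z w a b c d → (x * a + y * c) * z + (x * b + y * d) * w
                              ≡ x * (a * z + b * w) + y * (c * z + d * w)
    entry = solve-∀

  ·-identityˡ : ∀ A → I₂ · A ≡ A
  ·-identityˡ (mat a b c d) = mat-cong (entry₁ a c) (entry₁ b d) (entry₂ a c) (entry₂ b d)
    where
    entry₁ : ∀ x y → + 1 * x + + 0 * y ≡ x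
    entry₁ = solve-∀
    entry₂ : ∀ x y → + 0 * x + + 1 * y ≡ y
    entry₂ = solve-∀

  ·-identityʳ : ∀ A → A · I₂ ≡ A
  ·-identityʳ (mat a b c d) = mat-cong (entry₁ a b) (entry₂ a b) (entry₁ c d) (entry₂ c d)
    where
    entry₁ : ∀ x y → x * + 1 + y * + 0 ≡ x
    entry₁ = solve-∀
    entry₂ : ∀ x y → x * + 0 + y * + 1 ≡ y
    entry₂ = solve-∀

  ·-distribˡ-−ₘ : ∀ A P Q → A · (P −ₘ Q) ≡ (A · P) −ₘ (A · Q)
  ·-distribˡ-−ₘ (mat a b c d) (mat p₁ p₂ p₃ p₄) (mat q₁ q₂ q₃ q₄) =
    mat-cong (entry a b p₁ p₃ q₁ q₃) (entry a b p₂ p₄ q₂ q₄)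
             (entry c d p₁ p₃ q₁ q₃) (entry c d p₂ p₄ q₂ q₄)
    where
    entry : ∀ x y p p′ q q′ → x * (p - q) + y * (p′ - q′)
                            ≡ (x * p + y * p′) - (x * q + y * q′)
    entry = solve-∀

  ·-distribʳ-−ₘ : ∀ A P Q → (P −ₘ Q) · A ≡ (P · A) −ₘ (Q · A)
  ·-distribʳ-−ₘ (mat a b c d) (mat p₁ p₂ p₃ p₄) (mat q₁ q₂ q₃ q₄) =
    mat-cong (entry a c p₁ p₂ q₁ q₂) (entry b d p₁ p₂ q₁ q₂)
             (entry a c p₃ p₄ q₃ q₄) (entry b d p₃ p₄ q₃ q₄)
    where
    entry : ∀ x y p p′ q q′ → (p - q) * x + (p′ - q′) * y
                            ≡ (p * x + p′ * y) - (q * x + q′ * y)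
    entry = solve-∀

  commute-I₂ : ∀ A → Commute A I₂
  commute-I₂ A = trans (·-identityʳ A) (sym (·-identityˡ A))

  commute-^ₘ : ∀ A k → Commute A (A ^ₘ k)
  commute-^ₘ A zero    = commute-I₂ A
  commute-^ₘ A (suc k) = begin
    A · (A · (A ^ₘ k)) ≡⟨ cong (A ·_) (commute-^ₘ A k) ⟩
    A · ((A ^ₘ k) · A) ≡⟨ ·-assoc A (A ^ₘ k) A ⟨
    (A · (A ^ₘ k)) · A ∎
    where open ≡-Reasoning

  commute-−ₘ : ∀ {A P Q} → Commute A P → Commute A Q → Commute A (P −ₘ Q)
  commute-−ₘ {A} {P} {Q} AP≡PA AQ≡QA = begin
    A · (P −ₘ Q)          ≡⟨ ·-distribˡ-−ₘ A P Q ⟩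
    (A · P) −ₘ (A · Q)    ≡⟨ cong₂ _−ₘ_ AP≡PA AQ≡QA ⟩
    (P · A) −ₘ (Q · A)    ≡⟨ ·-distribʳ-−ₘ A P Q ⟨
    (P −ₘ Q) · A          ∎
    where open ≡-Reasoning

  P−ₘQ≡I₂⇒Q≡P−ₘI₂ : ∀ {P Q} → P −ₘ Q ≡ I₂ → Q ≡ P −ₘ I₂
  P−ₘQ≡I₂⇒Q≡P−ₘI₂ {mat p₁ p₂ p₃ p₄} {mat q₁ q₂ q₃ q₄} eq =
    mat-cong (entry p₁ q₁ (cong a eq)) (entry p₂ q₂ (cong b eq))
             (entry p₃ q₃ (cong c eq)) (entry p₄ q₄ (cong d eq))
    where
    entry : ∀ p q {r} → p - q ≡ r → q ≡ p - r
    entry p q refl = q≡p-[p-q] p q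
      where q≡p-[p-q] : ∀ p q → q ≡ p - (p - q)
            q≡p-[p-q] = solve-∀

  trace : M₂ℤ → ℤ
  trace A = a A + d A

  disc : M₂ℤ → ℤ
  disc A = trace A * trace A - + 4 * det A

  -- k A - q Z is a scalar matrix
  ScalarCombination : ℤ → ℤ → M₂ℤ → M₂ℤ → Set
  ScalarCombination k q A Z =
    k * b A ≡ q * b Z × k * c A ≡ q * c Z × k * (a A - d A) ≡ q * (a Z - d Z)

  private
    ≡-by-difference : ∀ {x y x′ y′} → x′ - y′ ≡ x - y → x ≡ y → x′ ≡ y′
    ≡-by-difference {x′ = x′} {y′} eq x≡y =
      ℤ.i-j≡0⇒i≡j x′ y′ (trans eq (ℤ.i≡j⇒i-j≡0 x≡y))

    commute-relations : ∀ A Z → Commute A Z →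
      b Z * c A ≡ b A * c Z ×
      b Z * (a A - d A) ≡ b A * (a Z - d Z) ×
      c Z * (a A - d A) ≡ c A * (a Z - d Z)
    commute-relations (mat e f g h) (mat a b c d) AZ≡ZA =
      ≡-by-difference (diff₁ e f g a b c) (sym (cong M₂ℤ.a AZ≡ZA)) ,
      ≡-by-difference (diff₂ e f h a b d) (cong M₂ℤ.b AZ≡ZA) ,
      ≡-by-difference (diff₃ e g h a c d) (sym (cong M₂ℤ.c AZ≡ZA))
      where
      diff₁ : ∀ e f g a b c → b * g - f * c ≡ (a * e + b * g) - (e * a + f * c)
      diff₁ = solve-∀
      diff₂ : ∀ e f h a b d → b * (e - h) - f * (a - d) ≡ (e * b + f * d) - (a * f + b * h)
      diff₂ = solve-∀
      diff₃ : ∀ e g h a c d → c * (e - h) - g * (a - d) ≡ (c * e + d * g) - (g * a + h * c)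
      diff₃ = solve-∀

    0≡y*x⇒x*y≡z*0 : ∀ x y z → + 0 ≡ y * x → x * y ≡ z * + 0
    0≡y*x⇒x*y≡z*0 x y z 0≡yx = trans (ℤ.*-comm x y) (trans (sym 0≡yx) (sym (ℤ.*-zeroʳ z)))

  -- The centralizer of a non-scalar matrix Z is spanned over ℚ by I₂ and Z.
  commute⇒scalarCombination : ∀ {A Z} → ¬ IsScalar Z → Commute A Z →
    Σ ℤ λ k → Σ ℤ λ q → k ≢ + 0 × ScalarCombination k q A Z
  commute⇒scalarCombination {A@(mat e f g h)} {Z@(mat a b c d)} Z≢scalar AZ≡ZA
    with commute-relations A Z AZ≡ZA | b ≟ + 0 | c ≟ + 0 | a ≟ d
  ... | r₁ , r₂ , r₃ | no b≢0   | _        | _       = b , f , b≢0 , ℤ.*-comm b f , r₁ , r₂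
  ... | r₁ , r₂ , r₃ | yes refl | no c≢0   | _       =
    c , g , c≢0 , 0≡y*x⇒x*y≡z*0 c f g r₁ , ℤ.*-comm c g , r₃
  ... | r₁ , r₂ , r₃ | yes refl | yes refl | no a≢d  =
    a - d , e - h , a≢d ∘ ℤ.i-j≡0⇒i≡j a d ,
    0≡y*x⇒x*y≡z*0 (a - d) f (e - h) r₂ ,
    0≡y*x⇒x*y≡z*0 (a - d) g (e - h) r₃ ,
    ℤ.*-comm (a - d) (e - h)
  ... | _            | yes refl | yes refl | yes a≡d = ⊥-elim (Z≢scalar (refl , refl , a≡d))

  commute-of-power-difference : ∀ {X Z} m → (X ^ₘ m) −ₘ Z ≡ I₂ → Commute X Z
  commute-of-power-difference {X} m Xᵐ−Z≡I =
    subst (Commute X) (sym (P−ₘQ≡I₂⇒Q≡P−ₘI₂ {X ^ₘ m} Xᵐ−Z≡I))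
          (commute-−ₘ {X} {X ^ₘ m} {I₂} (commute-^ₘ X m) (commute-I₂ X))

-- Fields of characteristic zero

IsSquare : (K : CharZeroField) → CharZeroField.Carrier K → Set
IsSquare K x = Σ Carrier λ s → s * s ≈ x
  where open CharZeroField K

IsSquare-resp : ∀ K {x y} → CharZeroField._≈_ K x y → IsSquare K x → IsSquare K y
IsSquare-resp K x≈y (s , s²≈x) = s , CharZeroField.trans K s²≈x x≈y

module FieldProperties (F : CharZeroField) where
  open CharZeroField F
  open import Algebra.Properties.Monoid.Mult +-monoid using (×-homo-+)
  open import Algebra.Properties.Semiring.Mult semiring using (×1-homo-*)
  open import Algebra.Properties.Ring ring using (-‿distribˡ-*; -‿distribʳ-*; -‿involutive; -0#≈0#)
  open import Algebra.Properties.AbelianGroup +-abelianGroup using (⁻¹-∙-comm)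
  open import Algebra.Properties.CommutativeSemigroup +-commutativeSemigroup using (interchange)
  open import Algebra.Properties.Group +-group public using (x∙y⁻¹≈ε⇒x≈y; x≈y⇒x∙y⁻¹≈ε)
  open import Relation.Binary.Reasoning.Setoid setoid

  private
    ι-homo-⊖ : ∀ m n → ι (m ⊖ n) ≈ (m ⊗ 1#) - (n ⊗ 1#)
    ι-homo-⊖ m       zero    = sym (trans (+-congˡ -0#≈0#) (+-identityʳ _))
    ι-homo-⊖ zero    (suc n) = sym (+-identityˡ _)
    ι-homo-⊖ (suc m) (suc n) = begin
      ι (suc m ⊖ suc n)          ≡⟨ ≡.cong ι (ℤ.[1+m]⊖[1+n]≡m⊖n m n) ⟩
      ι (m ⊖ n)                  ≈⟨ ι-homo-⊖ m n ⟩
      m′ - n′                    ≈⟨ +-identityˡ _ ⟨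
      0# + (m′ - n′)             ≈⟨ +-congʳ (-‿inverseʳ 1#) ⟨
      (1# - 1#) + (m′ - n′)      ≈⟨ interchange _ _ _ _ ⟩
      (1# + m′) + (- 1# + - n′)  ≈⟨ +-congˡ (⁻¹-∙-comm _ _) ⟩
      (1# + m′) - (1# + n′)      ∎
      where
      m′ n′ : Carrier
      m′ = m ⊗ 1#
      n′ = n ⊗ 1#

  ι-homo-+ : ∀ x y → ι (x ℤ.+ y) ≈ ι x + ι y
  ι-homo-+ (+ m)    (+ n)    = ×-homo-+ 1# m n
  ι-homo-+ (+ m)    -[1+ n ] = ι-homo-⊖ m (suc n)
  ι-homo-+ -[1+ m ] (+ n)    = trans (ι-homo-⊖ n (suc m)) (+-comm _ _)
  ι-homo-+ -[1+ m ] -[1+ n ] = begin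
    - (suc (suc (m ℕ.+ n)) ⊗ 1#)        ≡⟨ ≡.cong (λ k → - (suc k ⊗ 1#)) (ℕ.+-suc m n) ⟨
    - ((suc m ℕ.+ suc n) ⊗ 1#)          ≈⟨ -‿cong (×-homo-+ 1# (suc m) (suc n)) ⟩
    - (suc m ⊗ 1# + suc n ⊗ 1#)         ≈⟨ ⁻¹-∙-comm _ _ ⟨
    - (suc m ⊗ 1#) + - (suc n ⊗ 1#)     ∎

  ι-homo‿- : ∀ x → ι (ℤ.- x) ≈ - ι x
  ι-homo‿- (+ zero)  = sym -0#≈0#
  ι-homo‿- (+ suc n) = refl
  ι-homo‿- -[1+ n ]  = sym (-‿involutive _)

  ι-homo-- : ∀ x y → ι (x ℤ.- y) ≈ ι x - ι y
  ι-homo-- x y = trans (ι-homo-+ x (ℤ.- y)) (+-congˡ (ι-homo‿- y))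

  private
    ι-homo-*⁺ : ∀ m y → ι (+ m ℤ.* y) ≈ ι (+ m) * ι y
    ι-homo-*⁺ m (+ n)    = begin
      ι (+ m ℤ.* + n)    ≡⟨ ≡.cong ι (ℤ.pos-* m n) ⟨
      ι (+ (m ℕ.* n))    ≈⟨ ×1-homo-* m n ⟩
      ι (+ m) * ι (+ n)  ∎
    ι-homo-*⁺ m -[1+ n ] = begin
      ι (+ m ℤ.* ℤ.- (+ suc n))  ≡⟨ ≡.cong ι (ℤ.neg-distribʳ-* (+ m) (+ suc n)) ⟨
      ι (ℤ.- (+ m ℤ.* + suc n))  ≈⟨ ι-homo‿- (+ m ℤ.* + suc n) ⟩
      - ι (+ m ℤ.* + suc n)      ≈⟨ -‿cong (ι-homo-*⁺ m (+ suc n)) ⟩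
      - (ι (+ m) * ι (+ suc n))  ≈⟨ -‿distribʳ-* _ _ ⟩
      ι (+ m) * - ι (+ suc n)    ∎

  ι-homo-* : ∀ x y → ι (x ℤ.* y) ≈ ι x * ι y
  ι-homo-* (+ m)    y = ι-homo-*⁺ m y
  ι-homo-* -[1+ m ] y = begin
    ι (ℤ.- (+ suc m) ℤ.* y)    ≡⟨ ≡.cong ι (ℤ.neg-distribˡ-* (+ suc m) y) ⟨
    ι (ℤ.- (+ suc m ℤ.* y))    ≈⟨ ι-homo‿- (+ suc m ℤ.* y) ⟩
    - ι (+ suc m ℤ.* y)        ≈⟨ -‿cong (ι-homo-*⁺ (suc m) y) ⟩
    - (ι (+ suc m) * ι y)      ≈⟨ -‿distribˡ-* _ _ ⟩
    - ι (+ suc m) * ι y        ∎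

  ι-homo-1 : ι (+ 1) ≈ 1#
  ι-homo-1 = +-identityʳ 1#

  ι-cong-* : ∀ {x y z w} → x ℤ.* y ≡ z ℤ.* w → ι x * ι y ≈ ι z * ι w
  ι-cong-* {x} {y} {z} {w} eq =
    trans (sym (ι-homo-* x y)) (trans (reflexive (≡.cong ι eq)) (ι-homo-* z w))

  private
    -‿≈0 : ∀ {x} → - x ≈ 0# → x ≈ 0#
    -‿≈0 {x} -x≈0 = trans (sym (-‿involutive x)) (trans (-‿cong -x≈0) -0#≈0#)

  ι≈0⇒≡0 : ∀ z → ι z ≈ 0# → z ≡ + 0
  ι≈0⇒≡0 (+ zero)  _     = ≡.refl
  ι≈0⇒≡0 (+ suc k) ιz≈0  = ⊥-elim (charZero k ιz≈0)
  ι≈0⇒≡0 -[1+ k ]  ιz≈0  = ⊥-elim (charZero k (-‿≈0 ιz≈0))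

  x*y≈0⇒x≈0 : ∀ {x y} → ¬ y ≈ 0# → x * y ≈ 0# → x ≈ 0#
  x*y≈0⇒x≈0 {x} {y} y≉0 xy≈0 =
    let y⁻¹ , yy⁻¹≈1 = inverse y y≉0 in begin
    x               ≈⟨ *-identityʳ x ⟨
    x * 1#          ≈⟨ *-congˡ yy⁻¹≈1 ⟨
    x * (y * y⁻¹)   ≈⟨ *-assoc x y y⁻¹ ⟨
    (x * y) * y⁻¹   ≈⟨ *-congʳ xy≈0 ⟩
    0# * y⁻¹        ≈⟨ zeroˡ y⁻¹ ⟩
    0#              ∎

  *-≉0 : ∀ {x y} → ¬ x ≈ 0# → ¬ y ≈ 0# → ¬ x * y ≈ 0#
  *-≉0 x≉0 y≉0 xy≈0 = x≉0 (x*y≈0⇒x≈0 y≉0 xy≈0)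

  -- Equations are proved by writing lhs - rhs, via the ring solver, as a
  -- combination of terms already known to vanish.
  infixl 6 _+₀_
  _+₀_ : ∀ {x y} → x ≈ 0# → y ≈ 0# → x + y ≈ 0#
  x≈0 +₀ y≈0 = trans (+-cong x≈0 y≈0) (+-identityʳ 0#)

  infixl 7 _*₀_
  _*₀_ : ∀ c {x} → x ≈ 0# → c * x ≈ 0#
  c *₀ x≈0 = trans (*-congˡ x≈0) (zeroʳ c)

  private
    acr : ACR.AlmostCommutativeRing 0ℓ 0ℓ
    acr = ACR.fromCommutativeRing cring

    ι-morphism : ℤ.+-*-rawRing ACR.-Raw-AlmostCommutative⟶ acr
    ι-morphism = record
      { ⟦_⟧ = ι ; +-homo = ι-homo-+ ; *-homo = ι-homo-* ; -‿homo = ι-homo‿-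
      ; 0-homo = refl ; 1-homo = ι-homo-1 }

    ι-≟ : ∀ x y → Maybe (ι x ≈ ι y)
    ι-≟ x y with x ℤ.≟ y
    ... | yes ≡.refl = just refl
    ... | no _       = nothing

  open Algebra.Solver.Ring ℤ.+-*-rawRing acr ι-morphism ι-≟ public
    using (solve; _:=_; _:+_; _:*_; _:-_; :-_; con)

-- Eigenvectors of integer matrices

module LinearAlgebra (F : CharZeroField) where
  open CharZeroField F
  open FieldProperties F
  open import Algebra.Properties.Ring ring using (x[y-z]≈xy-xz; [y-z]x≈yx-zx; -‿distribˡ-*)
  import Relation.Binary.Reasoning.Setoid as SetoidReasoning

  K² : Set
  K² = Carrier × Carrier

  K²-setoid : Setoid 0ℓ 0ℓ
  K²-setoid = ×-setoid setoid setoid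

  open Setoid K²-setoid public using () renaming (_≈_ to _≈²_)

  module ≈-Reasoning = SetoidReasoning setoid
  module ≈²-Reasoning = SetoidReasoning K²-setoid

  NonZero : K² → Set
  NonZero (u₁ , u₂) = (¬ u₁ ≈ 0#) ⊎ (¬ u₂ ≈ 0#)

  infixr 7 _*²_ _·²_
  _*²_ : Carrier → K² → K²
  α *² (u₁ , u₂) = α * u₁ , α * u₂

  _·²_ : M₂ℤ → K² → K²
  mat a b c d ·² (u₁ , u₂) = ι a * u₁ + ι b * u₂ , ι c * u₁ + ι d * u₂

  Eigen : M₂ℤ → Carrier → K² → Set
  Eigen A α u = A ·² u ≈² α *² u

  IsEigenvalue : M₂ℤ → Carrier → Set
  IsEigenvalue A α = Σ K² λ u → NonZero u × Eigen A α u

  *²-congˡ : ∀ α {u v} → u ≈² v → α *² u ≈² α *² v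
  *²-congˡ α (u₁≈v₁ , u₂≈v₂) = *-congˡ u₁≈v₁ , *-congˡ u₂≈v₂

  *²-congʳ : ∀ {α β} u → α ≈ β → α *² u ≈² β *² u
  *²-congʳ u α≈β = *-congʳ α≈β , *-congʳ α≈β

  *²-assoc : ∀ α β u → α *² (β *² u) ≈² (α * β) *² u
  *²-assoc α β u = sym (*-assoc α β _) , sym (*-assoc α β _)

  *²-cancelʳ : ∀ {α β u} → NonZero u → α *² u ≈² β *² u → α ≈ β
  *²-cancelʳ {α} {β} (inj₁ u₁≉0) (αu₁≈βu₁ , _) =
    x∙y⁻¹≈ε⇒x≈y α β (x*y≈0⇒x≈0 u₁≉0 (trans ([y-z]x≈yx-zx _ α β) (x≈y⇒x∙y⁻¹≈ε αu₁≈βu₁)))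
  *²-cancelʳ {α} {β} (inj₂ u₂≉0) (_ , αu₂≈βu₂) =
    x∙y⁻¹≈ε⇒x≈y α β (x*y≈0⇒x≈0 u₂≉0 (trans ([y-z]x≈yx-zx _ α β) (x≈y⇒x∙y⁻¹≈ε αu₂≈βu₂)))

  ·²-congʳ : ∀ A {u v} → u ≈² v → A ·² u ≈² A ·² v
  ·²-congʳ (mat a b c d) (u₁≈v₁ , u₂≈v₂) =
    +-cong (*-congˡ u₁≈v₁) (*-congˡ u₂≈v₂) , +-cong (*-congˡ u₁≈v₁) (*-congˡ u₂≈v₂)

  ·²-*²-comm : ∀ A α u → A ·² (α *² u) ≈² α *² (A ·² u)
  ·²-*²-comm (mat a b c d) α (u₁ , u₂) = row (ι a) (ι b) , row (ι c) (ι d)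
    where
    row : ∀ x y → x * (α * u₁) + y * (α * u₂) ≈ α * (x * u₁ + y * u₂)
    row x y = solve 5 (λ x y α u₁ u₂ → x :* (α :* u₁) :+ y :* (α :* u₂) := α :* (x :* u₁ :+ y :* u₂))
                      refl x y α u₁ u₂

  ·²-homo-· : ∀ A B u → (A · B) ·² u ≈² A ·² (B ·² u)
  ·²-homo-· (mat a₁ b₁ c₁ d₁) (mat a₂ b₂ c₂ d₂) (u₁ , u₂) = row a₁ b₁ , row c₁ d₁
    where
    ι-homo-dot : ∀ x y z w → ι (x ℤ.* y ℤ.+ z ℤ.* w) ≈ ι x * ι y + ι z * ι w
    ι-homo-dot x y z w = trans (ι-homo-+ (x ℤ.* y) (z ℤ.* w)) (+-cong (ι-homo-* x y) (ι-homo-* z w))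
    row : ∀ x y → ι (x ℤ.* a₂ ℤ.+ y ℤ.* c₂) * u₁ + ι (x ℤ.* b₂ ℤ.+ y ℤ.* d₂) * u₂
                ≈ ι x * (ι a₂ * u₁ + ι b₂ * u₂) + ι y * (ι c₂ * u₁ + ι d₂ * u₂)
    row x y = trans (+-cong (*-congʳ (ι-homo-dot x a₂ y c₂)) (*-congʳ (ι-homo-dot x b₂ y d₂)))
      (solve 8 (λ x y a₂ b₂ c₂ d₂ u₁ u₂ →
         (x :* a₂ :+ y :* c₂) :* u₁ :+ (x :* b₂ :+ y :* d₂) :* u₂
           := x :* (a₂ :* u₁ :+ b₂ :* u₂) :+ y :* (c₂ :* u₁ :+ d₂ :* u₂))
         refl (ι x) (ι y) (ι a₂) (ι b₂) (ι c₂) (ι d₂) u₁ u₂)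

  eigen-I₂ : ∀ u → Eigen I₂ 1# u
  eigen-I₂ (u₁ , u₂) =
    trans (+-cong (*-congʳ ι-homo-1) (zeroˡ u₂)) (+-identityʳ _) ,
    trans (+-cong (zeroˡ u₁) (*-congʳ ι-homo-1)) (+-identityˡ _)

  eigen-· : ∀ {A B α β u} → Eigen A α u → Eigen B β u → Eigen (A · B) (α * β) u
  eigen-· {A} {B} {α} {β} {u} Au≈αu Bu≈βu = begin
    (A · B) ·² u    ≈⟨ ·²-homo-· A B u ⟩
    A ·² (B ·² u)   ≈⟨ ·²-congʳ A Bu≈βu ⟩
    A ·² (β *² u)   ≈⟨ ·²-*²-comm A β u ⟩
    β *² (A ·² u)   ≈⟨ *²-congˡ β Au≈αu ⟩
    β *² (α *² u)   ≈⟨ *²-assoc β α u ⟩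
    (β * α) *² u    ≈⟨ *²-congʳ u (*-comm β α) ⟩
    (α * β) *² u    ∎
    where open ≈²-Reasoning

  eigen-^ₘ : ∀ {A α u} → Eigen A α u → ∀ k → Eigen (A ^ₘ k) (α ^ k) u
  eigen-^ₘ {A} {u = u} Au≈αu zero    = eigen-I₂ u
  eigen-^ₘ {A}         Au≈αu (suc k) = eigen-· {A} {A ^ₘ k} Au≈αu (eigen-^ₘ {A} Au≈αu k)

  eigen-−ₘ : ∀ {A B α β u} → Eigen A α u → Eigen B β u → Eigen (A −ₘ B) (α - β) u
  eigen-−ₘ {mat a₁ b₁ c₁ d₁} {mat a₂ b₂ c₂ d₂} {α} {β} {u₁ , u₂} (A₁ , A₂) (B₁ , B₂) =
    row a₁ b₁ a₂ b₂ A₁ B₁ , row c₁ d₁ c₂ d₂ A₂ B₂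
    where
    row : ∀ x₁ y₁ x₂ y₂ {w} → ι x₁ * u₁ + ι y₁ * u₂ ≈ α * w → ι x₂ * u₁ + ι y₂ * u₂ ≈ β * w →
          ι (x₁ ℤ.- x₂) * u₁ + ι (y₁ ℤ.- y₂) * u₂ ≈ (α - β) * w
    row x₁ y₁ x₂ y₂ {w} r₁ r₂ = begin
      ι (x₁ ℤ.- x₂) * u₁ + ι (y₁ ℤ.- y₂) * u₂
        ≈⟨ +-cong (*-congʳ (ι-homo-- x₁ x₂)) (*-congʳ (ι-homo-- y₁ y₂)) ⟩
      (ι x₁ - ι x₂) * u₁ + (ι y₁ - ι y₂) * u₂
        ≈⟨ solve 6 (λ x₁ y₁ x₂ y₂ u₁ u₂ →
             (x₁ :- x₂) :* u₁ :+ (y₁ :- y₂) :* u₂ := (x₁ :* u₁ :+ y₁ :* u₂) :- (x₂ :* u₁ :+ y₂ :* u₂))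
             refl (ι x₁) (ι y₁) (ι x₂) (ι y₂) u₁ u₂ ⟩
      (ι x₁ * u₁ + ι y₁ * u₂) - (ι x₂ * u₁ + ι y₂ * u₂)
        ≈⟨ +-cong r₁ (-‿cong r₂) ⟩
      α * w - β * w
        ≈⟨ [y-z]x≈yx-zx w α β ⟨
      (α - β) * w ∎
      where open ≈-Reasoning

  eigen-scalar : ∀ {A} → IsScalar A → ∀ u → Eigen A (ι (a A)) u
  eigen-scalar {mat a b c d} (≡.refl , ≡.refl , ≡.refl) (u₁ , u₂) =
    trans (+-congˡ (zeroˡ u₂)) (+-identityʳ _) , trans (+-congʳ (zeroˡ u₁)) (+-identityˡ _)

  eigenvalue-unique : ∀ {A α β u} → NonZero u → Eigen A α u → Eigen A β u → α ≈ β
  eigenvalue-unique u≢0 Au≈αu Au≈βu =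
    *²-cancelʳ u≢0 (Setoid.trans K²-setoid (Setoid.sym K²-setoid Au≈αu) Au≈βu)

  charPoly : M₂ℤ → Carrier → Carrier
  charPoly A x = x * x - ι (trace A) * x + ι (det A)

  ι-homo-det : ∀ a b c d → ι (det (mat a b c d)) ≈ ι a * ι d - ι b * ι c
  ι-homo-det a b c d =
    trans (ι-homo-- (a ℤ.* d) (b ℤ.* c)) (+-cong (ι-homo-* a d) (-‿cong (ι-homo-* b c)))

  charPoly-entries : ∀ a b c d x →
    charPoly (mat a b c d) x ≈ x * x - (ι a + ι d) * x + (ι a * ι d - ι b * ι c)
  charPoly-entries a b c d x =
    +-cong (+-congˡ (-‿cong (*-congʳ (ι-homo-+ a d)))) (ι-homo-det a b c d)

  charPoly-root⇒IsQuadAlgInt : ∀ A {x} → charPoly A x ≈ 0# → IsQuadAlgInt x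
  charPoly-root⇒IsQuadAlgInt A {x} root = ℤ.- trace A , det A , trans (+-congʳ (+-congˡ monic)) root
    where
    monic : ι (ℤ.- trace A) * x ≈ - (ι (trace A) * x)
    monic = trans (*-congʳ (ι-homo‿- (trace A))) (sym (-‿distribˡ-* _ x))

  charPoly-root-≉0 : ∀ A {x} → det A ≢ + 0 → charPoly A x ≈ 0# → ¬ x ≈ 0#
  charPoly-root-≉0 A {x} detA≢0 root x≈0 = detA≢0 (ι≈0⇒≡0 (det A) (begin
    ι (det A)                              ≈⟨ +-identityˡ _ ⟨
    0# + ι (det A)                         ≈⟨ +-congʳ (zeroˡ (x - ι (trace A))) ⟨
    0# * (x - ι (trace A)) + ι (det A)     ≈⟨ +-congʳ (*-congʳ x≈0) ⟨
    x * (x - ι (trace A)) + ι (det A)      ≈⟨ +-congʳ (x[y-z]≈xy-xz x x (ι (trace A))) ⟩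
    x * x - x * ι (trace A) + ι (det A)    ≈⟨ +-congʳ (+-congˡ (-‿cong (*-comm x _))) ⟩
    charPoly A x                           ≈⟨ root ⟩
    0#                                     ∎))
    where open ≈-Reasoning

  eigenvalue-root : ∀ {A α u} → NonZero u → Eigen A α u → charPoly A α ≈ 0#
  eigenvalue-root {mat a b c d} {α} {u₁ , u₂} u≢0 (row₁ , row₂) =
    trans (charPoly-entries a b c d α) (cancel u≢0)
    where
    cancel : NonZero (u₁ , u₂) → α * α - (ι a + ι d) * α + (ι a * ι d - ι b * ι c) ≈ 0#
    cancel (inj₁ u₁≉0) = x*y≈0⇒x≈0 u₁≉0 (trans
      (solve 7 (λ a b c d α u₁ u₂ →
        (α :* α :- (a :+ d) :* α :+ (a :* d :- b :* c)) :* u₁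
          := (d :- α) :* ((a :* u₁ :+ b :* u₂) :- α :* u₁)
             :+ (:- b) :* ((c :* u₁ :+ d :* u₂) :- α :* u₂))
        refl (ι a) (ι b) (ι c) (ι d) α u₁ u₂)
      ((ι d - α) *₀ x≈y⇒x∙y⁻¹≈ε row₁ +₀ (- ι b) *₀ x≈y⇒x∙y⁻¹≈ε row₂))
    cancel (inj₂ u₂≉0) = x*y≈0⇒x≈0 u₂≉0 (trans
      (solve 7 (λ a b c d α u₁ u₂ →
        (α :* α :- (a :+ d) :* α :+ (a :* d :- b :* c)) :* u₂
          := (:- c) :* ((a :* u₁ :+ b :* u₂) :- α :* u₁)
             :+ (a :- α) :* ((c :* u₁ :+ d :* u₂) :- α :* u₂))
        refl (ι a) (ι b) (ι c) (ι d) α u₁ u₂)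
      ((- ι c) *₀ x≈y⇒x∙y⁻¹≈ε row₁ +₀ (ι a - α) *₀ x≈y⇒x∙y⁻¹≈ε row₂))

  ι-homo-disc : ∀ A → ι (disc A) ≈ ι (trace A) * ι (trace A) - ι (+ 4) * ι (det A)
  ι-homo-disc A = trans (ι-homo-- (trace A ℤ.* trace A) (+ 4 ℤ.* det A))
    (+-cong (ι-homo-* (trace A) (trace A)) (-‿cong (ι-homo-* (+ 4) (det A))))

  disc-root⇒charPoly-root : ∀ A {s} → s * s ≈ ι (disc A) → Σ Carrier λ ν → charPoly A ν ≈ 0#
  disc-root⇒charPoly-root A {s} s²≈disc =
    let h , 2h≈1 = inverse (ι (+ 2)) (charZero 1) in
    (t + s) * h , trans
      (solve 4 (λ t δ s h →
        ((t :+ s) :* h) :* ((t :+ s) :* h) :- t :* ((t :+ s) :* h) :+ δ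
          := (h :* h) :* (s :* s :- (t :* t :- con (+ 4) :* δ))
             :+ ((t :* t :+ t :* s) :* h :- δ :* (con (+ 1) :+ con (+ 2) :* h))
                :* (con (+ 2) :* h :- con (+ 1)))
        refl t (ι (det A)) s h)
      (h * h *₀ x≈y⇒x∙y⁻¹≈ε (trans s²≈disc (ι-homo-disc A))
        +₀ ((t * t + t * s) * h - ι (det A) * (ι (+ 1) + ι (+ 2) * h))
             *₀ x≈y⇒x∙y⁻¹≈ε (trans 2h≈1 (sym ι-homo-1)))
    where
    t : Carrier
    t = ι (trace A)

  private
    eigen-[b,ν-a] : ∀ a b c d ν → charPoly (mat a b c d) ν ≈ 0# →
                    Eigen (mat a b c d) ν (ι b , ν - ι a)
    eigen-[b,ν-a] a b c d ν root =
      solve 3 (λ a b ν → a :* b :+ b :* (ν :- a) := ν :* b) refl (ι a) (ι b) ν ,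
      sym (x∙y⁻¹≈ε⇒x≈y _ _ (trans
        (solve 5 (λ a b c d ν →
          ν :* (ν :- a) :- (c :* b :+ d :* (ν :- a)) := ν :* ν :- (a :+ d) :* ν :+ (a :* d :- b :* c))
          refl (ι a) (ι b) (ι c) (ι d) ν)
        (trans (sym (charPoly-entries a b c d ν)) root)))

    eigen-[ν-d,c] : ∀ a b c d ν → charPoly (mat a b c d) ν ≈ 0# →
                    Eigen (mat a b c d) ν (ν - ι d , ι c)
    eigen-[ν-d,c] a b c d ν root =
      sym (x∙y⁻¹≈ε⇒x≈y _ _ (trans
        (solve 5 (λ a b c d ν →
          ν :* (ν :- d) :- (a :* (ν :- d) :+ b :* c) := ν :* ν :- (a :+ d) :* ν :+ (a :* d :- b :* c))
          refl (ι a) (ι b) (ι c) (ι d) ν)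
        (trans (sym (charPoly-entries a b c d ν)) root))) ,
      solve 4 (λ b c d ν → c :* (ν :- d) :+ d :* c := ν :* c) refl (ι b) (ι c) (ι d) ν

    eigen-diagonal : ∀ a d → Eigen (mat a (+ 0) (+ 0) d) (ι a) (1# , 0#)
    eigen-diagonal a d =
      trans (+-congˡ (zeroˡ 0#)) (+-identityʳ _) ,
      trans (+-cong (zeroˡ 1#) (zeroʳ (ι d))) (trans (+-identityʳ 0#) (sym (zeroʳ (ι a))))

  private
    eigenpair-of-root : ∀ a b c d ν → charPoly (mat a b c d) ν ≈ 0# →
                        Dec (b ≡ + 0) → Dec (c ≡ + 0) → Σ Carrier (IsEigenvalue (mat a b c d))
    eigenpair-of-root a b c d ν root (no b≢0) _ =
      ν , (ι b , ν - ι a) , inj₁ (b≢0 ∘ ι≈0⇒≡0 b) , eigen-[b,ν-a] a b c d ν root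
    eigenpair-of-root a _ c d ν root (yes ≡.refl) (no c≢0) =
      ν , (ν - ι d , ι c) , inj₂ (c≢0 ∘ ι≈0⇒≡0 c) , eigen-[ν-d,c] a (+ 0) c d ν root
    eigenpair-of-root a _ _ d ν root (yes ≡.refl) (yes ≡.refl) =
      ι a , (1# , 0#) , inj₁ 1≉0 , eigen-diagonal a d

  disc-root⇒eigenvalue : ∀ A {s} → s * s ≈ ι (disc A) → Σ Carrier (IsEigenvalue A)
  disc-root⇒eigenvalue (mat a b c d) s²≈disc =
    let ν , root = disc-root⇒charPoly-root (mat a b c d) s²≈disc in
    eigenpair-of-root a b c d ν root (b ℤ.≟ + 0) (c ℤ.≟ + 0)

  *²-cancelˡ-invertible : ∀ {x x′ y w u} → x * x′ ≈ 1# → x *² w ≈² y *² u → w ≈² (x′ * y) *² u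
  *²-cancelˡ-invertible {x} {x′} {y} xx′≈1 (xw₁≈yu₁ , xw₂≈yu₂) = cancel xw₁≈yu₁ , cancel xw₂≈yu₂
    where
    cancel : ∀ {w v} → x * w ≈ y * v → w ≈ (x′ * y) * v
    cancel {w} {v} xw≈yv = begin
      w               ≈⟨ *-identityˡ w ⟨
      1# * w          ≈⟨ *-congʳ (trans (*-comm x′ x) xx′≈1) ⟨
      (x′ * x) * w    ≈⟨ *-assoc x′ x w ⟩
      x′ * (x * w)    ≈⟨ *-congˡ xw≈yv ⟩
      x′ * (y * v)    ≈⟨ *-assoc x′ y v ⟨
      (x′ * y) * v    ∎
      where open ≈-Reasoning

  scalarCombination⇒scaled-eigen : ∀ {k q A Z ν u} → ScalarCombination k q A Z → Eigen Z ν u →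
    ι k *² (A ·² u) ≈² (ι k * ι (a A) + ι q * (ν - ι (a Z))) *² u
  scalarCombination⇒scaled-eigen {k} {q} {mat e f g h} {mat a b c d} {ν} {u₁ , u₂}
                          (kf≡qb , kg≡qc , k[e-h]≡q[a-d]) (row₁ , row₂) =
    x∙y⁻¹≈ε⇒x≈y _ _ (trans
      (solve 9 (λ k q e f a b ν u₁ u₂ →
        k :* (e :* u₁ :+ f :* u₂) :- (k :* e :+ q :* (ν :- a)) :* u₁
          := u₂ :* (k :* f :- q :* b) :+ q :* ((a :* u₁ :+ b :* u₂) :- ν :* u₁))
        refl (ι k) (ι q) (ι e) (ι f) (ι a) (ι b) ν u₁ u₂)
      (u₂ *₀ x≈y⇒x∙y⁻¹≈ε (ι-cong-* {k} {f} {q} {b} kf≡qb) +₀ ι q *₀ x≈y⇒x∙y⁻¹≈ε row₁)) ,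
    x∙y⁻¹≈ε⇒x≈y _ _ (trans
      (solve 11 (λ k q e g h a c d ν u₁ u₂ →
        k :* (g :* u₁ :+ h :* u₂) :- (k :* e :+ q :* (ν :- a)) :* u₂
          := u₁ :* (k :* g :- q :* c) :+ q :* ((c :* u₁ :+ d :* u₂) :- ν :* u₂)
             :+ (:- u₂) :* (k :* (e :- h) :- q :* (a :- d)))
        refl (ι k) (ι q) (ι e) (ι g) (ι h) (ι a) (ι c) (ι d) ν u₁ u₂)
      (u₁ *₀ x≈y⇒x∙y⁻¹≈ε (ι-cong-* {k} {g} {q} {c} kg≡qc) +₀ ι q *₀ x≈y⇒x∙y⁻¹≈ε row₂
        +₀ (- u₂) *₀ x≈y⇒x∙y⁻¹≈ε k[e-h]≈q[a-d]))
    where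
    k[e-h]≈q[a-d] : ι k * (ι e - ι h) ≈ ι q * (ι a - ι d)
    k[e-h]≈q[a-d] = trans (*-congˡ (sym (ι-homo-- e h)))
      (trans (ι-cong-* {k} {e ℤ.- h} {q} {a ℤ.- d} k[e-h]≡q[a-d]) (*-congˡ (ι-homo-- a d)))

  eigen-of-commuting : ∀ {A Z ν u} → ¬ IsScalar Z → Commute A Z → Eigen Z ν u →
    Σ Carrier λ α → Eigen A α u
  eigen-of-commuting {A} {Z} {ν} Z≢scalar AZ≡ZA Zu≈νu =
    let k , q , k≢0 , kA-qZ = commute⇒scalarCombination {A} {Z} Z≢scalar AZ≡ZA
        k⁻¹ , kk⁻¹≈1       = inverse (ι k) (k≢0 ∘ ι≈0⇒≡0 k)
    in k⁻¹ * (ι k * ι (a A) + ι q * (ν - ι (a Z))) ,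
       *²-cancelˡ-invertible {ι k} kk⁻¹≈1
         (scalarCombination⇒scaled-eigen {k} {q} {A} {Z} kA-qZ Zu≈νu)

  eigenvalue-IsQuadAlgInt : ∀ {A α} → det A ≢ + 0 → IsEigenvalue A α → IsQuadAlgInt α × ¬ α ≈ 0#
  eigenvalue-IsQuadAlgInt {A} detA≢0 (u , u≢0 , Au≈αu) =
    let root = eigenvalue-root {A} u≢0 Au≈αu in
    charPoly-root⇒IsQuadAlgInt A root , charPoly-root-≉0 A detA≢0 root

  difference-of-eigenvalues : ∀ {P Q α β u} → P −ₘ Q ≡ I₂ → NonZero u →
                              Eigen P α u → Eigen Q β u → α - β ≈ 1#
  difference-of-eigenvalues {P} {Q} {α} {β} {u} P−Q≡I u≢0 Pu≈αu Qu≈βu =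
    eigenvalue-unique {I₂} u≢0
      (≡.subst (λ M → Eigen M (α - β) u) P−Q≡I (eigen-−ₘ {P} {Q} Pu≈αu Qu≈βu)) (eigen-I₂ u)

  private
    solution-by-cases : ∀ m n X Y → (X ^ₘ m) −ₘ (Y ^ₘ n) ≡ I₂ →
      Σ Carrier (IsEigenvalue X) → Σ Carrier (IsEigenvalue Y) → Dec (IsScalar (Y ^ₘ n)) →
      Σ Carrier λ x → Σ Carrier λ y → IsEigenvalue X x × IsEigenvalue Y y × x ^ m - y ^ n ≈ 1#
    solution-by-cases m n X Y eq (x , v , v≢0 , Xv≈xv) (y , w , w≢0 , Yw≈yw) (yes Yⁿ-scalar) =
      x , y , (v , v≢0 , Xv≈xv) , (w , w≢0 , Yw≈yw) , (begin
        x ^ m - y ^ n            ≈⟨ +-congˡ (-‿cong yⁿ≈z) ⟩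
        x ^ m - ι (a (Y ^ₘ n))   ≈⟨ difference-of-eigenvalues {X ^ₘ m} {Y ^ₘ n} eq v≢0
                                      (eigen-^ₘ {X} Xv≈xv m) (eigen-scalar {Y ^ₘ n} Yⁿ-scalar v) ⟩
        1#                       ∎)
      where
      open ≈-Reasoning
      yⁿ≈z : y ^ n ≈ ι (a (Y ^ₘ n))
      yⁿ≈z = eigenvalue-unique {Y ^ₘ n} w≢0
               (eigen-^ₘ {Y} Yw≈yw n) (eigen-scalar {Y ^ₘ n} Yⁿ-scalar w)
    solution-by-cases m n X Y eq _ (y , w , w≢0 , Yw≈yw) (no Yⁿ-nonscalar) =
      let x , Xw≈xw = eigen-of-commuting {X} {Y ^ₘ n} Yⁿ-nonscalar
                        (commute-of-power-difference m eq) (eigen-^ₘ {Y} Yw≈yw n)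
      in x , y , (w , w≢0 , Xw≈xw) , (w , w≢0 , Yw≈yw) ,
         difference-of-eigenvalues {X ^ₘ m} {Y ^ₘ n} eq w≢0
           (eigen-^ₘ {X} Xw≈xw m) (eigen-^ₘ {Y} Yw≈yw n)

  eigenvalues-of-solution : ∀ m n X Y → (X ^ₘ m) −ₘ (Y ^ₘ n) ≡ I₂ →
    IsSquare F (ι (disc X)) → IsSquare F (ι (disc Y)) →
    Σ Carrier λ x → Σ Carrier λ y → IsEigenvalue X x × IsEigenvalue Y y × x ^ m - y ^ n ≈ 1#
  eigenvalues-of-solution m n X Y eq (_ , √discX) (_ , √discY) =
    solution-by-cases m n X Y eq (disc-root⇒eigenvalue X √discX) (disc-root⇒eigenvalue Y √discY)
                      (isScalar? (Y ^ₘ n))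

-- The rationals

module _ where
  open ≡

  private
    open RawSemiringDefinitions (Semiring.rawSemiring (CommutativeRing.semiring ℚ.+-*-commutativeRing))
      using () renaming (_×_ to _×ℚ_)

    toℚᵘ-×1 : ∀ k → toℚᵘ (k ×ℚ 1ℚ) ≃ᵘ mkℚᵘ (+ k) 0
    toℚᵘ-×1 zero    = ℚᵘ.≃-refl
    toℚᵘ-×1 (suc k) = ℚᵘ.≃-trans (ℚ.toℚᵘ-homo-+ 1ℚ (k ×ℚ 1ℚ))
      (ℚᵘ.≃-trans (ℚᵘ.+-congʳ ℚᵘ.1ℚᵘ (toℚᵘ-×1 k)) (*≡* (1+k-numerator (+ k))))
      where
      1+k-numerator : ∀ k → (+ 1 ℤ.* + 1 ℤ.+ k ℤ.* + 1) ℤ.* + 1 ≡ (+ 1 ℤ.+ k) ℤ.* + 1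
      1+k-numerator = solve-∀

  ℚ-field : CharZeroField
  ℚ-field = record
    { cring    = ℚ.+-*-commutativeRing
    ; 1≉0      = λ ()
    ; inverse  = λ p p≢0 → (ℚ.1/ p) {{ℚ.≢-nonZero p≢0}} , ℚ.*-inverseʳ p {{ℚ.≢-nonZero p≢0}}
    ; charZero = λ k 1+k≡0 → 1+k≢0 k (ℚᵘ.≃-trans (ℚᵘ.≃-sym (toℚᵘ-×1 (suc k))) (ℚ.toℚᵘ-cong 1+k≡0))
    }
    where
    1+k≢0 : ∀ k → ¬ (mkℚᵘ (+ suc k) 0 ≃ᵘ mkℚᵘ (+ 0) 0)
    1+k≢0 k (*≡* ())

  open CharZeroField ℚ-field using () renaming (ι to ιℚ)

  private
    toℚᵘ-ι : ∀ w → toℚᵘ (ιℚ w) ≃ᵘ mkℚᵘ w 0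
    toℚᵘ-ι (+ n)    = toℚᵘ-×1 n
    toℚᵘ-ι -[1+ n ] = ℚᵘ.≃-trans (ℚ.toℚᵘ-homo‿- (suc n ×ℚ 1ℚ)) (ℚᵘ.-‿cong (toℚᵘ-×1 (suc n)))

  -- The denominator q of r divides n², is coprime to the numerator n, hence q = 1.
  rational-sqrt-of-integer : ∀ r w → r ℚ.* r ≡ ιℚ w → Σ ℤ λ k → k ℤ.* k ≡ w
  rational-sqrt-of-integer r@(mkℚ n q-1 n⊥q) w r²≡w = n , n²≡w
    where
    q : ℕ
    q = suc q-1
    n²≡wq² : (n ℤ.* n) ℤ.* + 1 ≡ w ℤ.* + (q ℕ.* q)
    n²≡wq² with ℚᵘ.≃-trans (ℚᵘ.≃-sym (ℚ.toℚᵘ-homo-* r r))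
                           (ℚᵘ.≃-trans (ℚ.toℚᵘ-cong r²≡w) (toℚᵘ-ι w))
    ... | *≡* eq = eq
    ∣n∣²≡∣w∣q·q : ℤ.∣ n ∣ ℕ.* ℤ.∣ n ∣ ≡ (ℤ.∣ w ∣ ℕ.* q) ℕ.* q
    ∣n∣²≡∣w∣q·q = begin
      ℤ.∣ n ∣ ℕ.* ℤ.∣ n ∣          ≡⟨ ℤ.abs-* n n ⟨
      ℤ.∣ n ℤ.* n ∣                ≡⟨ cong ℤ.∣_∣ (ℤ.*-identityʳ (n ℤ.* n)) ⟨
      ℤ.∣ n ℤ.* n ℤ.* + 1 ∣        ≡⟨ cong ℤ.∣_∣ n²≡wq² ⟩
      ℤ.∣ w ℤ.* + (q ℕ.* q) ∣      ≡⟨ ℤ.abs-* w (+ (q ℕ.* q)) ⟩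
      ℤ.∣ w ∣ ℕ.* (q ℕ.* q)        ≡⟨ ℕ.*-assoc ℤ.∣ w ∣ q q ⟨
      (ℤ.∣ w ∣ ℕ.* q) ℕ.* q        ∎
      where open ≡-Reasoning
    q≡1 : q ≡ 1
    q≡1 = n⊥q′ (coprime-divisor (Coprimality.sym n⊥q′) (divides (ℤ.∣ w ∣ ℕ.* q) ∣n∣²≡∣w∣q·q) ,
                ∣-refl)
      where
      n⊥q′ : Coprime ℤ.∣ n ∣ q
      n⊥q′ = recompute (coprime? ℤ.∣ n ∣ q) n⊥q
    n²≡w : n ℤ.* n ≡ w
    n²≡w = begin
      n ℤ.* n                  ≡⟨ ℤ.*-identityʳ (n ℤ.* n) ⟨
      n ℤ.* n ℤ.* + 1          ≡⟨ n²≡wq² ⟩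
      w ℤ.* + (q ℕ.* q)        ≡⟨ cong (λ x → w ℤ.* + (x ℕ.* x)) q≡1 ⟩
      w ℤ.* + 1                ≡⟨ ℤ.*-identityʳ w ⟩
      w                        ∎
      where open ≡-Reasoning

  ℕ-square? : ∀ n → Dec (Σ ℕ λ j → j ℕ.* j ≡ n)
  ℕ-square? n = map′ (λ (j , _ , j²≡n) → j , j²≡n) (λ (j , j²≡n) → j , j<1+n j j²≡n , j²≡n)
                     (ℕ.anyUpTo? (λ j → j ℕ.* j ℕ.≟ n) (suc n))
    where
    j<1+n : ∀ j → j ℕ.* j ≡ n → j < suc n
    j<1+n zero    _    = ℕ.s≤s ℕ.z≤n
    j<1+n (suc j) j²≡n = ℕ.s≤s (subst (suc j ℕ.≤_) j²≡n (ℕ.m≤m*n (suc j) (suc j)))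

  private
    k*k≡+∣k∣² : ∀ k → k ℤ.* k ≡ + (ℤ.∣ k ∣ ℕ.* ℤ.∣ k ∣)
    k*k≡+∣k∣² (+ m)    = sym (ℤ.pos-* m m)
    k*k≡+∣k∣² -[1+ m ] = refl

  ℤ-square? : ∀ w → Dec (Σ ℤ λ k → k ℤ.* k ≡ w)
  ℤ-square? (+ n) =
    map′ (λ (j , j²≡n) → + j , trans (sym (ℤ.pos-* j j)) (cong +_ j²≡n))
         (λ (k , k²≡n) → ℤ.∣ k ∣ , ℤ.+-injective (trans (sym (k*k≡+∣k∣² k)) k²≡n))
         (ℕ-square? n)
  ℤ-square? -[1+ n ] = no λ (k , k²≡w) → +≢-[1+n] (trans (sym (k*k≡+∣k∣² k)) k²≡w)
    where
    +≢-[1+n] : ∀ {m} → + m ≢ -[1+ n ]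
    +≢-[1+n] ()

  ℚ-square? : ∀ w → Dec (IsSquare ℚ-field (ιℚ w))
  ℚ-square? w =
    map′ (λ (k , k²≡w) → ιℚ k , trans (sym (ι-homo-* k k)) (cong ιℚ k²≡w))
         (λ (r , r²≡w) → rational-sqrt-of-integer r w r²≡w)
         (ℤ-square? w)
    where open FieldProperties ℚ-field using (ι-homo-*)

-- Adjoining square roots

module AdjoinSquareRoot (F : CharZeroField) (D : ℤ)
                        (D-nonsquare : ¬ IsSquare F (CharZeroField.ι F D)) where
  open CharZeroField F
  open FieldProperties F
  open import Algebra.Properties.Ring ring using (-0#≈0#)

  δ : Carrier
  δ = ι D

  -- (p , q) stands for p + q √δ
  E : Set
  E = Carrier × Carrier

  +-abelianGroupₑ : AbelianGroup 0ℓ 0ℓ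
  +-abelianGroupₑ = abelianGroup +-abelianGroup +-abelianGroup

  infixl 7 _*ₑ_
  _*ₑ_ : E → E → E
  (p₁ , q₁) *ₑ (p₂ , q₂) = p₁ * p₂ + δ * (q₁ * q₂) , p₁ * q₂ + q₁ * p₂

  1ₑ : E
  1ₑ = 1# , 0#

  open AbelianGroup +-abelianGroupₑ using () renaming (_≈_ to _≈ₑ_; _∙_ to _+ₑ_; sym to symₑ)

  *ₑ-cong : ∀ {x y u v} → x ≈ₑ y → u ≈ₑ v → x *ₑ u ≈ₑ y *ₑ v
  *ₑ-cong (p₁≈ , q₁≈) (p₂≈ , q₂≈) =
    +-cong (*-cong p₁≈ p₂≈) (*-congˡ (*-cong q₁≈ q₂≈)) , +-cong (*-cong p₁≈ q₂≈) (*-cong q₁≈ p₂≈)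

  *ₑ-comm : ∀ x y → x *ₑ y ≈ₑ y *ₑ x
  *ₑ-comm (p₁ , q₁) (p₂ , q₂) =
    solve 5 (λ δ p₁ q₁ p₂ q₂ → p₁ :* p₂ :+ δ :* (q₁ :* q₂) := p₂ :* p₁ :+ δ :* (q₂ :* q₁))
            refl δ p₁ q₁ p₂ q₂ ,
    solve 4 (λ p₁ q₁ p₂ q₂ → p₁ :* q₂ :+ q₁ :* p₂ := p₂ :* q₁ :+ q₂ :* p₁) refl p₁ q₁ p₂ q₂

  *ₑ-assoc : ∀ x y z → (x *ₑ y) *ₑ z ≈ₑ x *ₑ (y *ₑ z)
  *ₑ-assoc (p₁ , q₁) (p₂ , q₂) (p₃ , q₃) =
    solve 7 (λ δ p₁ q₁ p₂ q₂ p₃ q₃ →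
      (p₁ :* p₂ :+ δ :* (q₁ :* q₂)) :* p₃ :+ δ :* ((p₁ :* q₂ :+ q₁ :* p₂) :* q₃)
        := p₁ :* (p₂ :* p₃ :+ δ :* (q₂ :* q₃)) :+ δ :* (q₁ :* (p₂ :* q₃ :+ q₂ :* p₃)))
      refl δ p₁ q₁ p₂ q₂ p₃ q₃ ,
    solve 7 (λ δ p₁ q₁ p₂ q₂ p₃ q₃ →
      (p₁ :* p₂ :+ δ :* (q₁ :* q₂)) :* q₃ :+ (p₁ :* q₂ :+ q₁ :* p₂) :* p₃
        := p₁ :* (p₂ :* q₃ :+ q₂ :* p₃) :+ q₁ :* (p₂ :* p₃ :+ δ :* (q₂ :* q₃)))
      refl δ p₁ q₁ p₂ q₂ p₃ q₃

  *ₑ-identityˡ : ∀ x → 1ₑ *ₑ x ≈ₑ x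
  *ₑ-identityˡ (p , q) =
    trans (+-cong (*-identityˡ p) (trans (*-congˡ (zeroˡ q)) (zeroʳ δ))) (+-identityʳ p) ,
    trans (+-cong (*-identityˡ q) (zeroˡ p)) (+-identityʳ q)

  *ₑ-distribˡ : ∀ x y z → x *ₑ (y +ₑ z) ≈ₑ (x *ₑ y) +ₑ (x *ₑ z)
  *ₑ-distribˡ (p₁ , q₁) (p₂ , q₂) (p₃ , q₃) =
    solve 7 (λ δ p₁ q₁ p₂ q₂ p₃ q₃ →
      p₁ :* (p₂ :+ p₃) :+ δ :* (q₁ :* (q₂ :+ q₃))
        := (p₁ :* p₂ :+ δ :* (q₁ :* q₂)) :+ (p₁ :* p₃ :+ δ :* (q₁ :* q₃)))
      refl δ p₁ q₁ p₂ q₂ p₃ q₃ ,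
    solve 6 (λ p₁ q₁ p₂ q₂ p₃ q₃ →
      p₁ :* (q₂ :+ q₃) :+ q₁ :* (p₂ :+ p₃) := (p₁ :* q₂ :+ q₁ :* p₂) :+ (p₁ :* q₃ :+ q₁ :* p₃))
      refl p₁ q₁ p₂ q₂ p₃ q₃

  cringₑ : CommutativeRing 0ℓ 0ℓ
  cringₑ = record
    { Carrier           = E
    ; _≈_               = _≈ₑ_
    ; _+_               = _+ₑ_
    ; _*_               = _*ₑ_
    ; -_                = AbelianGroup._⁻¹ +-abelianGroupₑ
    ; 0#                = AbelianGroup.ε +-abelianGroupₑ
    ; 1#                = 1ₑ
    ; isCommutativeRing = record
      { isRing = record
        { +-isAbelianGroup = AbelianGroup.isAbelianGroup +-abelianGroupₑ
        ; *-cong           = *ₑ-cong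
        ; *-assoc          = *ₑ-assoc
        ; *-identity       = comm∧idˡ⇒id *ₑ-comm *ₑ-identityˡ
        ; distrib          = comm∧distrˡ⇒distr (AbelianGroup.∙-cong +-abelianGroupₑ)
                                               *ₑ-comm *ₑ-distribˡ
        }
      ; *-comm = *ₑ-comm
      }
    }
    where open Consequences (AbelianGroup.setoid +-abelianGroupₑ)

  private
    δ≉0 : ¬ δ ≈ 0#
    δ≉0 δ≈0 = D-nonsquare (0# , trans (zeroˡ 0#) (sym δ≈0))

  norm-≉0 : ∀ p q → ¬ (p ≈ 0# × q ≈ 0#) → ¬ p * p - δ * (q * q) ≈ 0#
  norm-≉0 p q p,q≉0 N≈0 = ¬q≉0 q≉0
    where
    q≉0 : ¬ q ≈ 0#
    q≉0 q≈0 = *-≉0 p≉0 p≉0 (trans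
      (solve 3 (λ p q δ → p :* p := (p :* p :- δ :* (q :* q)) :+ δ :* (q :* q)) refl p q δ)
      (N≈0 +₀ δ *₀ trans (*-congʳ q≈0) (zeroˡ q)))
      where
      p≉0 : ¬ p ≈ 0#
      p≉0 p≈0 = p,q≉0 (p≈0 , q≈0)
    ¬q≉0 : ¬ ¬ q ≈ 0#
    ¬q≉0 q≉0 =
      let q⁻¹ , qq⁻¹≈1 = inverse q q≉0 in
      D-nonsquare (p * q⁻¹ , x∙y⁻¹≈ε⇒x≈y _ _ (trans
      (solve 4 (λ p q q⁻¹ δ →
        (p :* q⁻¹) :* (p :* q⁻¹) :- δ
          := (q⁻¹ :* q⁻¹) :* (p :* p :- δ :* (q :* q))
             :+ (δ :* (q :* q⁻¹ :+ con (+ 1))) :* (q :* q⁻¹ :- con (+ 1)))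
        refl p q q⁻¹ δ)
      (q⁻¹ * q⁻¹ *₀ N≈0 +₀ δ * (q * q⁻¹ + ι (+ 1)) *₀ x≈y⇒x∙y⁻¹≈ε (trans qq⁻¹≈1 (sym ι-homo-1)))))

  inverseₑ : ∀ x → ¬ x ≈ₑ (0# , 0#) → Σ E λ y → x *ₑ y ≈ₑ 1ₑ
  inverseₑ (p , q) x≉0 =
    let n , Nn≈1 = inverse (p * p - δ * (q * q)) (norm-≉0 p q x≉0) in
    (p * n , - (q * n)) ,
    trans (solve 4 (λ p q n δ →
             p :* (p :* n) :+ δ :* (q :* (:- (q :* n))) := (p :* p :- δ :* (q :* q)) :* n)
             refl p q n δ) Nn≈1 ,
    solve 3 (λ p q n → p :* (:- (q :* n)) :+ q :* (p :* n) := con (+ 0)) refl p q n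

  private
    open RawSemiringDefinitions (Semiring.rawSemiring (CommutativeRing.semiring cringₑ))
      using () renaming (_×_ to _⊗ₑ_)

    ×1-embed : ∀ n → n ⊗ₑ 1ₑ ≈ₑ (n ⊗ 1# , 0#)
    ×1-embed zero    = refl , refl
    ×1-embed (suc n) =
      +-congˡ (proj₁ (×1-embed n)) , trans (+-congˡ (proj₂ (×1-embed n))) (+-identityʳ 0#)

  extension : CharZeroField
  extension = record
    { cring    = cringₑ
    ; 1≉0      = λ (1≈0 , _) → 1≉0 1≈0
    ; inverse  = inverseₑ
    ; charZero = λ k (1+k≈0 , _) → charZero k (trans (sym (proj₁ (×1-embed (suc k)))) 1+k≈0)
    }

  open CharZeroField extension using () renaming (ι to ιₑ)

  ι-embed : ∀ w → ιₑ w ≈ₑ (ι w , 0#)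
  ι-embed (+ n)    = ×1-embed n
  ι-embed -[1+ n ] =
    -‿cong (proj₁ (×1-embed (suc n))) , trans (-‿cong (proj₂ (×1-embed (suc n)))) -0#≈0#

  embed-square : ∀ {x} → IsSquare F x → IsSquare extension (x , 0#)
  embed-square (s , s²≈x) =
    (s , 0#) ,
    trans (+-congˡ (trans (*-congˡ (zeroˡ 0#)) (zeroʳ δ))) (trans (+-identityʳ _) s²≈x) ,
    trans (+-cong (zeroʳ s) (zeroˡ s)) (+-identityʳ 0#)

  √δ : IsSquare extension (δ , 0#)
  √δ = (0# , 1#) ,
    trans (+-cong (zeroˡ 0#) (*-congˡ (*-identityˡ 1#))) (trans (+-identityˡ _) (*-identityʳ δ)) ,
    trans (+-cong (zeroˡ 1#) (zeroʳ 1#)) (+-identityʳ 0#)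

  √D : IsSquare extension (ιₑ D)
  √D = IsSquare-resp extension (symₑ (ι-embed D)) √δ

  integer-square-lifts : ∀ w → IsSquare F (ι w) → IsSquare extension (ιₑ w)
  integer-square-lifts w = IsSquare-resp extension (symₑ (ι-embed w)) ∘ embed-square

  δ-multiple-square : ∀ {x} → IsSquare F (δ * x) → IsSquare extension (x , 0#)
  δ-multiple-square {x} (r , r²≈δx) =
    let δ⁻¹ , δδ⁻¹≈1 = inverse δ δ≉0 in
    (0# , r * δ⁻¹) ,
    x∙y⁻¹≈ε⇒x≈y _ _ (trans
      (solve 4 (λ δ δ⁻¹ r x →
        con (+ 0) :* con (+ 0) :+ δ :* ((r :* δ⁻¹) :* (r :* δ⁻¹)) :- x
          := (δ :* (δ⁻¹ :* δ⁻¹)) :* (r :* r :- δ :* x)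
             :+ (x :* (δ :* δ⁻¹ :+ con (+ 1))) :* (δ :* δ⁻¹ :- con (+ 1)))
        refl δ δ⁻¹ r x)
      (δ * (δ⁻¹ * δ⁻¹) *₀ x≈y⇒x∙y⁻¹≈ε r²≈δx
        +₀ x * (δ * δ⁻¹ + ι (+ 1)) *₀ x≈y⇒x∙y⁻¹≈ε (trans δδ⁻¹≈1 (sym ι-homo-1)))) ,
    solve 1 (λ y → con (+ 0) :* y :+ y :* con (+ 0) := con (+ 0)) refl (r * δ⁻¹)

  -- (p + q √δ)² = x forces 2pq = 0: if p = 0 then δ x is a square, if q = 0 then x is.
  nonsquare-stays-nonsquare : ∀ {x} → ¬ IsSquare F x → ¬ IsSquare F (δ * x) →
                              ¬ IsSquare extension (x , 0#)
  nonsquare-stays-nonsquare {x} x-nonsquare δx-nonsquare ((p , q) , real , imaginary) = ¬p≉0 p≉0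
    where
    p≉0 : ¬ p ≈ 0#
    p≉0 p≈0 = δx-nonsquare (δ * q , x∙y⁻¹≈ε⇒x≈y _ _ (trans
      (solve 4 (λ δ p q x →
        (δ :* q) :* (δ :* q) :- δ :* x := δ :* ((p :* p :+ δ :* (q :* q)) :- x) :+ (:- (δ :* p)) :* p)
        refl δ p q x)
      (δ *₀ x≈y⇒x∙y⁻¹≈ε real +₀ (- (δ * p)) *₀ p≈0)))
    ¬p≉0 : ¬ ¬ p ≈ 0#
    ¬p≉0 p≉0 = x-nonsquare (p , x∙y⁻¹≈ε⇒x≈y _ _ (trans
      (solve 4 (λ δ p q x →
        p :* p :- x := ((p :* p :+ δ :* (q :* q)) :- x) :+ (:- (δ :* q)) :* q)
        refl δ p q x)
      (x≈y⇒x∙y⁻¹≈ε real +₀ (- (δ * q)) *₀ q≈0)))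
      where
      q≈0 : q ≈ 0#
      q≈0 = x*y≈0⇒x≈0 (*-≉0 p≉0 (charZero 1)) (trans
        (solve 2 (λ p q → q :* (p :* con (+ 2)) := p :* q :+ q :* p) refl p q) imaginary)

  embedded-square? : ∀ {x} → Dec (IsSquare F x) → Dec (IsSquare F (δ * x)) →
                     Dec (IsSquare extension (x , 0#))
  embedded-square? (yes x-square)    _                  = yes (embed-square x-square)
  embedded-square? (no _)            (yes δx-square)    = yes (δ-multiple-square δx-square)
  embedded-square? (no x-nonsquare)  (no δx-nonsquare)  =
    no (nonsquare-stays-nonsquare x-nonsquare δx-nonsquare)

  extension-integer-square? : ∀ w → Dec (IsSquare F (ι w)) → Dec (IsSquare F (ι (D ℤ.* w))) →
                              Dec (IsSquare extension (ιₑ w))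
  extension-integer-square? w w? Dw? =
    map′ (IsSquare-resp extension (symₑ (ι-embed w))) (IsSquare-resp extension (ι-embed w))
         (embedded-square? w? (map′ (IsSquare-resp F (ι-homo-* D w))
                                    (IsSquare-resp F (sym (ι-homo-* D w))) Dw?))

-- Adjoining √D yields a field only when D is not yet a square, so the squares among
-- the integers must stay decidable along the tower.
record FieldWithDecidableSquares : Set₁ where
  field
    K               : CharZeroField
    integer-square? : ∀ w → Dec (IsSquare K (CharZeroField.ι K w))

open FieldWithDecidableSquares

ℚ-withDecidableSquares : FieldWithDecidableSquares
ℚ-withDecidableSquares = record { K = ℚ-field ; integer-square? = ℚ-square? }

adjoin-√ : ∀ S D → Σ FieldWithDecidableSquares λ S′ →
  IsSquare (K S′) (CharZeroField.ι (K S′) D) ×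
  (∀ w → IsSquare (K S) (CharZeroField.ι (K S) w) → IsSquare (K S′) (CharZeroField.ι (K S′) w))
adjoin-√ S D with integer-square? S D
... | yes D-square    = S , D-square , λ _ w-square → w-square
... | no D-nonsquare  =
  record { K = extension
         ; integer-square? = λ w →
             extension-integer-square? w (integer-square? S w) (integer-square? S (D ℤ.* w)) } ,
  √D , integer-square-lifts
  where
  open AdjoinSquareRoot (K S) D D-nonsquare

field-with-square-roots : ∀ D₁ D₂ → Σ CharZeroField λ K →
  IsSquare K (CharZeroField.ι K D₁) × IsSquare K (CharZeroField.ι K D₂)
field-with-square-roots D₁ D₂ =
  let S₁ , √D₁ , _         = adjoin-√ ℚ-withDecidableSquares D₁
      S₂ , √D₂ , squares↑ = adjoin-√ S₁ D₂
  in K S₂ , squares↑ D₁ √D₁ , √D₂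

lemma4p4 : (m n : ℕ) → m ≥ 3 → n ≥ 3 →
    Σ M₂ℤ (λ X → Σ M₂ℤ (λ Y →
      ¬ (det X *ℤ det Y ≡ + 0) × ((X ^ₘ m) −ₘ (Y ^ₘ n) ≡ I₂))) →
    Σ CharZeroField (λ K → let open CharZeroField K in
      Σ Carrier (λ x → Σ Carrier (λ y →
        IsQuadAlgInt x × IsQuadAlgInt y × ¬ ((x * y) ≈ 0#) ×
        (((x ^ m) - (y ^ n)) ≈ 1#))))
lemma4p4 m n _ _ (X , Y , detXdetY≢0 , Xᵐ−Yⁿ≡I) =
  let K , √discX , √discY               = field-with-square-roots (disc X) (disc Y)
      open LinearAlgebra K
      x , y , x-eigen , y-eigen , xᵐ−yⁿ≈1 = eigenvalues-of-solution m n X Y Xᵐ−Yⁿ≡I √discX √discY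
      x-quadratic , x≉0                  = eigenvalue-IsQuadAlgInt {X} detX≢0 x-eigen
      y-quadratic , y≉0                  = eigenvalue-IsQuadAlgInt {Y} detY≢0 y-eigen
  in K , x , y , x-quadratic , y-quadratic , FieldProperties.*-≉0 K x≉0 y≉0 , xᵐ−yⁿ≈1
  where
  detX≢0 : det X ≢ + 0
  detX≢0 detX≡0 = detXdetY≢0 (≡.cong (_*ℤ det Y) detX≡0)
  detY≢0 : det Y ≢ + 0
  detY≢0 detY≡0 = detXdetY≢0 (≡.trans (≡.cong (det X *ℤ_) detY≡0) (ℤ.*-zeroʳ (det X)))
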